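{- Let $k\ge 2$ be an integer and let $a,b,c$ be positive integers. Let $G$ be the graph with vertex set partitioned as $V_0\cup V_1\cup\cdots\cup V_k$, where $|V_0|=a$, $|V_1|=\cdots=|V_{k-1}|=b$, $|V_k|=c$, whose edges are: all edges between $V_0$ and $V_1$, all edges between $V_{k-1}$ and $V_k$, and the edges of $b$ vertex-disjoint paths of length $k-2$ from $V_1$ to $V_{k-1}$, each containing exactly one vertex of $V_i$ for every $1\le i\le k-1$ (and no other edges). Then $G$ is diameter-$k$-critical.
   Context: All graphs are finite and simple. The diameter of a graph is the maximum over vertex pairs of the length of a shortest path between them ($\infty$ if disconnected). A graph is diameter-$k$-critical if its diameter is $k$ and deleting any single edge yields a graph of diameter strictly larger than $k$. -}

module Defs where

open import Data.Nat using (ℕ; zero; suc; _≤_; _<_; _∸_)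
open import Data.Fin using (Fin; toℕ)
open import Data.Product using (Σ; _×_; ∃₂)
open import Data.Sum using (_⊎_)
open import Relation.Nullary using (¬_)
open import Relation.Binary.PropositionalEquality using (_≡_)

data Walk {V : Set} (E : V → V → Set) : V → V → ℕ → Set where
  nil  : ∀ {x} → Walk E x x 0
  cons : ∀ {x y z n} → E x y → Walk E y z n → Walk E x z (suc n)

-- dist(x,y) ≤ k  (shortest path length is at most k; false if x,y are
-- in different components, i.e. dist = ∞)
DistLe : {V : Set} → (V → V → Set) → ℕ → V → V → Set
DistLe E k x y = Σ ℕ λ n → n ≤ k × Walk E x y n

HasDiameter : {V : Set} → (V → V → Set) → ℕ → Set
HasDiameter {V} E k =
  (∀ (x y : V) → DistLe E k x y) ×
  ∃₂ λ (x y : V) → ∀ n → n < k → ¬ Walk E x y n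

DiameterGreaterThan : {V : Set} → (V → V → Set) → ℕ → Set
DiameterGreaterThan {V} E k = ∃₂ λ (x y : V) → ¬ DistLe E k x y

DeleteEdge : {V : Set} → (V → V → Set) → V → V → (V → V → Set)
DeleteEdge E u v x y = E x y × ¬ (x ≡ u × y ≡ v) × ¬ (x ≡ v × y ≡ u)

DiameterCritical : {V : Set} → (V → V → Set) → ℕ → Set
DiameterCritical {V} E k =
  HasDiameter E k ×
  (∀ (u v : V) → E u v → DiameterGreaterThan (DeleteEdge E u v) k)

-- Vertices: V₀ = {v0 x | x < a}, V_{i+1} = {mid i j | j < b} for
-- i < k-1 (so layers V₁,…,V_{k-1}), V_k = {vk z | z < c}.
-- The j-th path is  mid 0 j — mid 1 j — … — mid (k-2) j.

data Vtx (k a b c : ℕ) : Set where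
  v0  : Fin a → Vtx k a b c
  mid : Fin (k ∸ 1) → Fin b → Vtx k a b c
  vk  : Fin c → Vtx k a b c

-- one orientation of each edge
data Arc {k a b c : ℕ} : Vtx k a b c → Vtx k a b c → Set where
  arc01   : ∀ x (i : Fin (k ∸ 1)) j → toℕ i ≡ 0 → Arc (v0 x) (mid i j)
  arcPath : ∀ (i i' : Fin (k ∸ 1)) j → toℕ i' ≡ suc (toℕ i) → Arc (mid i j) (mid i' j)
  arcLast : ∀ (i : Fin (k ∸ 1)) j z → suc (toℕ i) ≡ k ∸ 1 → Arc (mid i j) (vk z)

Adj : (k a b c : ℕ) → Vtx k a b c → Vtx k a b c → Set
Adj k a b c x y = Arc x y ⊎ Arc y x

-- A vertex of layer l (1 ≤ l ≤ k − 1) is joined to V₀ by a walk of length l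
-- and to V_k by one of length k − l.  Two layer vertices are joined through
-- V₀ or through V_k; the two route lengths sum to 2k, so one is at most k.
--
-- A potential φ changing by at most one along each edge gives φ x ≤ n + φ y
-- for every walk of length n from x to y.  The layer index keeps V_k at
-- distance k from V₀.  After deleting an edge, an explicit potential of this
-- kind vanishes at one end of the deleted edge and exceeds k on its path
-- beyond the other end: that part of the path can then only be reached the
-- long way round, through V₀ or V_k.
module Submission where

open import Defs
open import Data.Nat using (ℕ; zero; suc; _+_; _∸_; _≤_; _<_; z≤n; s≤s; s≤s⁻¹; _≤?_)
open import Data.Nat.Properties
  using (≤-refl; ≤-trans; ≤-reflexive; n≤1+n; m≤n⇒m≤1+n; m≤m+n; m≤n+m; +-suc; +-comm;
         +-identityʳ; +-monoʳ-≤; +-∸-assoc; m∸n+n≡m; m≤n+o⇒m∸n≤o; n∸n≡0; m∸n≤m;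
         <⇒≱; ≰⇒>; ≤-antisym; suc-injective; module ≤-Reasoning)
open import Data.Fin using (Fin; toℕ; fromℕ; fromℕ<; _≟_) renaming (zero to fzero)
open import Data.Fin.Properties using (toℕ-injective; toℕ-fromℕ; toℕ-fromℕ<; toℕ≤pred[n])
open import Data.Product using (_×_; _,_; proj₁; proj₂)
open import Data.Sum using (_⊎_; inj₁; inj₂)
open import Data.Empty using (⊥-elim)
open import Relation.Nullary using (¬_; yes; no)
open import Relation.Binary.PropositionalEquality
  using (_≡_; refl; sym; trans; cong; subst; ≡-≟-identity)

∸-suc : ∀ {m n} → suc n ≤ m → m ∸ n ≡ suc (m ∸ suc n)
∸-suc = +-∸-assoc 1

∸+∸≤ : ∀ {m l l'} → l ≤ m → m ≤ l + l' → (m ∸ l) + (m ∸ l') ≤ m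
∸+∸≤ {m} {l} {l'} l≤m m≤l+l' = begin
  (m ∸ l) + (m ∸ l') ≤⟨ +-monoʳ-≤ (m ∸ l) (m≤n+o⇒m∸n≤o m l' (≤-trans m≤l+l' (≤-reflexive (+-comm l l')))) ⟩
  (m ∸ l) + l        ≡⟨ m∸n+n≡m l≤m ⟩
  m                  ∎
  where open ≤-Reasoning

suc+suc≤ : ∀ {m n k} → m + n ≤ k → suc m + suc n ≤ suc (suc k)
suc+suc≤ {m} {n} m+n≤k = s≤s (≤-trans (≤-reflexive (+-suc m n)) (s≤s m+n≤k))

_≈₁_ : ℕ → ℕ → Set
m ≈₁ n = m ≤ suc n × n ≤ suc m

≈₁-refl : ∀ {n} → n ≈₁ n
≈₁-refl = n≤1+n _ , n≤1+n _

n≈₁1+n : ∀ {n} → n ≈₁ suc n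
n≈₁1+n = m≤n⇒m≤1+n (n≤1+n _) , ≤-refl

1+n≈₁n : ∀ {n} → suc n ≈₁ n
1+n≈₁n = ≤-refl , m≤n⇒m≤1+n (n≤1+n _)

Lipschitz : {V : Set} → (V → V → Set) → (V → ℕ) → Set
Lipschitz E φ = ∀ {p q} → E p q → φ p ≤ suc (φ q)

module _ {V : Set} {E : V → V → Set} where

  _∷ʳ_ : ∀ {x y z n} → Walk E x y n → E y z → Walk E x z (suc n)
  nil      ∷ʳ e = cons e nil
  cons f w ∷ʳ e = cons f (w ∷ʳ e)

  _++_ : ∀ {x y z m n} → Walk E x y m → Walk E y z n → Walk E x z (m + n)
  nil      ++ w' = w'
  cons e w ++ w' = cons e (w ++ w')

  reverse : (∀ {x y} → E x y → E y x) → ∀ {x y n} → Walk E x y n → Walk E y x n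
  reverse E-sym nil        = nil
  reverse E-sym (cons e w) = reverse E-sym w ∷ʳ E-sym e

  lipschitz-walk : ∀ {φ} → Lipschitz E φ → ∀ {x y n} → Walk E x y n → φ x ≤ n + φ y
  lipschitz-walk lip nil        = ≤-refl
  lipschitz-walk lip (cons e w) = ≤-trans (lip e) (s≤s (lipschitz-walk lip w))

  lipschitz-root : ∀ {φ} → Lipschitz E φ → ∀ {x y n} → φ y ≡ 0 → Walk E x y n → φ x ≤ n
  lipschitz-root {φ} lip {x} {y} {n} φy≡0 w =
    subst (φ x ≤_) (trans (cong (n +_) φy≡0) (+-identityʳ n)) (lipschitz-walk lip w)

  lipschitz⇒¬DistLe : ∀ {φ k x y} → Lipschitz E φ → φ y ≡ 0 → k < φ x → ¬ DistLe E k x y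
  lipschitz⇒¬DistLe lip φy≡0 k<φx (n , n≤k , w) =
    <⇒≱ (≤-trans (s≤s n≤k) k<φx) (lipschitz-root lip φy≡0 w)

module _ {V : Set} {R : V → V → Set} where

  private
    E : V → V → Set
    E x y = R x y ⊎ R y x

  arcs-close⇒lipschitz : ∀ {φ : V → ℕ} → (∀ {p q} → R p q → φ p ≈₁ φ q) → Lipschitz E φ
  arcs-close⇒lipschitz close (inj₁ r) = proj₁ (close r)
  arcs-close⇒lipschitz close (inj₂ r) = proj₂ (close r)

  other-arcs-close⇒lipschitz : ∀ {φ : V → ℕ} {u v} →
    (∀ {p q} → R p q → ¬ (p ≡ u × q ≡ v) → φ p ≈₁ φ q) → Lipschitz (DeleteEdge E u v) φ
  other-arcs-close⇒lipschitz close (inj₁ r , ¬uv , _)   = proj₁ (close r ¬uv)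
  other-arcs-close⇒lipschitz close (inj₂ r , _   , ¬vu) =
    proj₂ (close r λ { (p≡u , q≡v) → ¬vu (q≡v , p≡u) })

deleteEdge-comm : ∀ {V} {E : V → V → Set} {u v x y} → DeleteEdge E u v x y → DeleteEdge E v u x y
deleteEdge-comm (e , ¬uv , ¬vu) = e , ¬vu , ¬uv

mapWalk : ∀ {V} {E E' : V → V → Set} → (∀ {x y} → E x y → E' x y) →
          ∀ {x y n} → Walk E x y n → Walk E' x y n
mapWalk f nil        = nil
mapWalk f (cons e w) = cons (f e) (mapWalk f w)

diameter>-⊆ : ∀ {V} {E E' : V → V → Set} {k} → (∀ {x y} → E' x y → E x y) →
              DiameterGreaterThan E k → DiameterGreaterThan E' k
diameter>-⊆ E'⊆E (x , y , ¬d) = x , y , λ { (n , n≤k , w) → ¬d (n , n≤k , mapWalk E'⊆E w) }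

-- k = m + 2, so the paths have m + 1 vertices; mid l j lies in layer V_{l+1}.
module Layered (m a b c : ℕ) where

  K : ℕ
  K = suc (suc m)

  G : Set
  G = Vtx K a b c

  E : G → G → Set
  E = Adj K a b c

  L : Set
  L = Fin (suc m)

  flipE : ∀ {x y} → E x y → E y x
  flipE (inj₁ r) = inj₂ r
  flipE (inj₂ r) = inj₁ r

  toℕ≤m : (l : L) → toℕ l ≤ m
  toℕ≤m = toℕ≤pred[n]

  climb : ∀ j d (l l' : L) → d + toℕ l ≡ toℕ l' → Walk E (mid l j) (mid l' j) d
  climb j zero    l l' eq = subst (λ l'' → Walk E (mid l j) (mid l'' j) 0) (toℕ-injective eq) nil
  climb j (suc d) l l' eq = cons (inj₁ (arcPath l next j (toℕ-fromℕ< next<))) (climb j d next l' eq')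
    where
      next< : suc (toℕ l) < suc m
      next< = s≤s (≤-trans (s≤s (m≤n+m (toℕ l) d)) (≤-trans (≤-reflexive eq) (toℕ≤m l')))
      next : L
      next = fromℕ< next<
      eq' : d + toℕ next ≡ toℕ l'
      eq' rewrite toℕ-fromℕ< next< | +-suc d (toℕ l) = eq

  lastArc : ∀ j z → E (mid (fromℕ m) j) (vk z)
  lastArc j z = inj₁ (arcLast (fromℕ m) j z (cong suc (toℕ-fromℕ m)))

  v0⇝mid : ∀ x j (l : L) → Walk E (v0 x) (mid l j) (suc (toℕ l))
  v0⇝mid x j l = cons (inj₁ (arc01 x fzero j refl)) (climb j (toℕ l) fzero l (+-identityʳ _))

  mid⇝vk : ∀ j (l : L) z → Walk E (mid l j) (vk z) (suc (m ∸ toℕ l))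
  mid⇝vk j l z =
    climb j (m ∸ toℕ l) l (fromℕ m) (trans (m∸n+n≡m (toℕ≤m l)) (sym (toℕ-fromℕ m))) ∷ʳ lastArc j z

  DistLe-sym : ∀ {x y} → DistLe E K x y → DistLe E K y x
  DistLe-sym (n , n≤K , w) = n , n≤K , reverse flipE w

  within : ∀ {x y n} → n ≤ K → Walk E x y n → DistLe E K x y
  within n≤K w = _ , n≤K , w

  2≤K : 2 ≤ K
  2≤K = s≤s (s≤s z≤n)

  mid-mid : Fin a → Fin c → ∀ l j l' j' → DistLe E K (mid l j) (mid l' j')
  mid-mid x z l j l' j' with toℕ l + toℕ l' ≤? m
  ... | yes l+l'≤m = within (suc+suc≤ l+l'≤m) (reverse flipE (v0⇝mid x j l) ++ v0⇝mid x j' l')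
  ... | no  l+l'≰m = within (suc+suc≤ (∸+∸≤ (toℕ≤m l) (≤-trans (n≤1+n m) (≰⇒> l+l'≰m))))
                            (mid⇝vk j l z ++ reverse flipE (mid⇝vk j' l' z))

  diameter≤ : Fin a → Fin b → Fin c → ∀ x y → DistLe E K x y
  diameter≤ x₀ j₀ z₀ = dist
    where
      v0-v0 : ∀ x x' → DistLe E K (v0 x) (v0 x')
      v0-v0 x x' = within 2≤K (v0⇝mid x j₀ fzero ++ reverse flipE (v0⇝mid x' j₀ fzero))

      v0-mid : ∀ x l j → DistLe E K (v0 x) (mid l j)
      v0-mid x l j = within (s≤s (m≤n⇒m≤1+n (toℕ≤m l))) (v0⇝mid x j l)

      v0-vk : ∀ x z → DistLe E K (v0 x) (vk z)
      v0-vk x z = within ≤-refl (v0⇝mid x j₀ fzero ++ mid⇝vk j₀ fzero z)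

      mid-vk : ∀ l j z → DistLe E K (mid l j) (vk z)
      mid-vk l j z = within (s≤s (m≤n⇒m≤1+n (m∸n≤m m (toℕ l)))) (mid⇝vk j l z)

      vk-vk : ∀ z z' → DistLe E K (vk z) (vk z')
      vk-vk z z' = within 2≤K (cons (flipE (lastArc j₀ z)) (cons (lastArc j₀ z') nil))

      dist : ∀ x y → DistLe E K x y
      dist (v0 x)    (v0 x')     = v0-v0 x x'
      dist (v0 x)    (mid l j)   = v0-mid x l j
      dist (v0 x)    (vk z)      = v0-vk x z
      dist (mid l j) (v0 x)      = DistLe-sym (v0-mid x l j)
      dist (mid l j) (mid l' j') = mid-mid x₀ z₀ l j l' j'
      dist (mid l j) (vk z)      = mid-vk l j z
      dist (vk z)    (v0 x)      = DistLe-sym (v0-vk x z)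
      dist (vk z)    (mid l j)   = DistLe-sym (mid-vk l j z)
      dist (vk z)    (vk z')     = vk-vk z z'

  level : G → ℕ
  level (v0 _)    = 0
  level (mid l _) = suc (toℕ l)
  level (vk _)    = K

  level-close : ∀ {p q} → Arc p q → level p ≈₁ level q
  level-close (arc01 x l j l≡0)       rewrite l≡0     = n≈₁1+n
  level-close (arcPath l l' j l'≡1+l) rewrite l'≡1+l = n≈₁1+n
  level-close (arcLast l j z 1+l≡1+m) rewrite 1+l≡1+m = n≈₁1+n

  level-lipschitz : Lipschitz E level
  level-lipschitz = arcs-close⇒lipschitz {φ = level} level-close

  vk-v0-far : ∀ z x n → n < K → ¬ Walk E (vk z) (v0 x) n
  vk-v0-far z x n n<K w = <⇒≱ n<K (lipschitz-root level-lipschitz refl w)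

  record Separator (u v : G) : Set where
    field
      potential : G → ℕ
      close     : ∀ {p q} → Arc p q → ¬ (p ≡ u × q ≡ v) → potential p ≈₁ potential q
      near far  : G
      near≡0    : potential near ≡ 0
      K<far     : K < potential far

  separator⇒diameter> : ∀ {u v} → Separator u v → DiameterGreaterThan (DeleteEdge E u v) K
  separator⇒diameter> s =
    far , near , lipschitz⇒¬DistLe (other-arcs-close⇒lipschitz {φ = potential} close) near≡0 K<far
    where open Separator s

  module FirstEdge (x₀ : Fin a) (i₀ : L) (j₀ : Fin b) (i₀≡0 : toℕ i₀ ≡ 0) where

    φ : G → ℕ
    φ (v0 x) with x ≟ x₀
    ... | yes _ = 0
    ... | no  _ = 2
    φ (mid l j) with j ≟ j₀
    ... | yes _ = 3 + toℕ l
    ... | no  _ = suc (toℕ l)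
    φ (vk _) = K

    close : ∀ {p q} → Arc p q → ¬ (p ≡ v0 x₀ × q ≡ mid i₀ j₀) → φ p ≈₁ φ q
    close (arc01 x l j l≡0) ¬deleted with x ≟ x₀ | j ≟ j₀
    ... | yes refl | yes refl = ⊥-elim (¬deleted (refl , cong (λ i → mid i j₀) (toℕ-injective (trans l≡0 (sym i₀≡0)))))
    ... | yes _    | no  _    rewrite l≡0 = n≈₁1+n
    ... | no  _    | yes _    rewrite l≡0 = n≈₁1+n
    ... | no  _    | no  _    rewrite l≡0 = 1+n≈₁n
    close (arcPath l l' j l'≡1+l) _ with j ≟ j₀
    ... | yes _ rewrite l'≡1+l = n≈₁1+n
    ... | no  _ rewrite l'≡1+l = n≈₁1+n
    close (arcLast l j z 1+l≡1+m) _ with j ≟ j₀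
    ... | yes _ rewrite 1+l≡1+m = 1+n≈₁n
    ... | no  _ rewrite 1+l≡1+m = n≈₁1+n

    separator : Separator (v0 x₀) (mid i₀ j₀)
    separator = record
      { potential = φ ; close = close ; near = v0 x₀ ; far = mid (fromℕ m) j₀
      ; near≡0 = near≡0 ; K<far = K<far }
      where
        near≡0 : φ (v0 x₀) ≡ 0
        near≡0 rewrite ≡-≟-identity _≟_ (refl {x = x₀}) = refl
        K<far : K < φ (mid (fromℕ m) j₀)
        K<far rewrite ≡-≟-identity _≟_ (refl {x = j₀}) | toℕ-fromℕ m = ≤-refl

  module PathEdge (i₀ i₁ : L) (j₀ : Fin b) (i₁≡1+i₀ : toℕ i₁ ≡ suc (toℕ i₀)) where

    -- Away from path j₀ and V_k, φ is the distance from mid i₀ j₀ once the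
    -- edge is deleted; V_k and path j₀ past the deleted edge all get value top.
    t top : ℕ
    t   = toℕ i₀
    top = 3 + (m + t)

    t<m : t < m
    t<m = subst (_≤ m) i₁≡1+i₀ (toℕ≤m i₁)

    φ : G → ℕ
    φ (v0 _) = suc t
    φ (mid l j) with j ≟ j₀
    ... | no  _ = 2 + (toℕ l + t)
    ... | yes _ with toℕ l ≤? t
    ...   | yes _ = t ∸ toℕ l
    ...   | no  _ = top
    φ (vk _) = top

    close : ∀ {p q} → Arc p q → ¬ (p ≡ mid i₀ j₀ × q ≡ mid i₁ j₀) → φ p ≈₁ φ q
    close (arc01 x l j l≡0) _ with j ≟ j₀
    ... | no _ rewrite l≡0 = n≈₁1+n
    ... | yes _ with toℕ l ≤? t
    ...   | yes _   rewrite l≡0 = 1+n≈₁n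
    ...   | no  l≰t = ⊥-elim (l≰t (subst (_≤ t) (sym l≡0) z≤n))
    close (arcPath l l' j l'≡1+l) ¬deleted with j ≟ j₀
    ... | no _ rewrite l'≡1+l = n≈₁1+n
    ... | yes refl with toℕ l ≤? t | toℕ l' ≤? t
    ...   | yes _   | yes l'≤t rewrite l'≡1+l | ∸-suc l'≤t = 1+n≈₁n
    ...   | yes l≤t | no  l'≰t = ⊥-elim (¬deleted (cong (λ i → mid i j₀) l≡i₀ , cong (λ i → mid i j₀) l'≡i₁))
      where
        l≡t : toℕ l ≡ t
        l≡t = ≤-antisym l≤t (s≤s⁻¹ (subst (t <_) l'≡1+l (≰⇒> l'≰t)))
        l≡i₀ : l ≡ i₀
        l≡i₀ = toℕ-injective l≡t
        l'≡i₁ : l' ≡ i₁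
        l'≡i₁ = toℕ-injective (trans l'≡1+l (trans (cong suc l≡t) (sym i₁≡1+i₀)))
    ...   | no  l≰t | yes l'≤t = ⊥-elim (l≰t (≤-trans (n≤1+n _) (subst (_≤ t) l'≡1+l l'≤t)))
    ...   | no  _   | no  _    = ≈₁-refl
    close (arcLast l j z 1+l≡1+m) _ with j ≟ j₀
    ... | no _ rewrite suc-injective 1+l≡1+m = n≈₁1+n
    ... | yes _ with toℕ l ≤? t
    ...   | yes l≤t = ⊥-elim (<⇒≱ t<m (subst (_≤ t) (suc-injective 1+l≡1+m) l≤t))
    ...   | no  _   = ≈₁-refl

    separator : Separator (mid i₀ j₀) (mid i₁ j₀)
    separator = record
      { potential = φ ; close = close ; near = mid i₀ j₀ ; far = mid i₁ j₀
      ; near≡0 = near≡0 ; K<far = K<far }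
      where
        near≡0 : φ (mid i₀ j₀) ≡ 0
        near≡0 rewrite ≡-≟-identity _≟_ (refl {x = j₀}) with t ≤? t
        ... | yes _   = n∸n≡0 t
        ... | no  t≰t = ⊥-elim (t≰t ≤-refl)
        K<far : K < φ (mid i₁ j₀)
        K<far rewrite ≡-≟-identity _≟_ (refl {x = j₀}) with toℕ i₁ ≤? t
        ... | yes i₁≤t = ⊥-elim (<⇒≱ (subst (t <_) (sym i₁≡1+i₀) ≤-refl) i₁≤t)
        ... | no  _    = s≤s (s≤s (s≤s (m≤m+n m t)))

  module LastEdge (i₀ : L) (j₀ : Fin b) (z₀ : Fin c) (1+i₀≡1+m : suc (toℕ i₀) ≡ suc m) where

    φ : G → ℕ
    φ (v0 _) = K
    φ (mid l j) with j ≟ j₀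
    ... | yes _ = 3 + (m ∸ toℕ l)
    ... | no  _ = suc (m ∸ toℕ l)
    φ (vk z) with z ≟ z₀
    ... | yes _ = 0
    ... | no  _ = 2

    close : ∀ {p q} → Arc p q → ¬ (p ≡ mid i₀ j₀ × q ≡ vk z₀) → φ p ≈₁ φ q
    close (arc01 x l j l≡0) _ with j ≟ j₀
    ... | yes _ rewrite l≡0 = n≈₁1+n
    ... | no  _ rewrite l≡0 = 1+n≈₁n
    close (arcPath l l' j l'≡1+l) _ with j ≟ j₀
    ... | yes _ rewrite ∸-suc (subst (_≤ m) l'≡1+l (toℕ≤m l')) | l'≡1+l = 1+n≈₁n
    ... | no  _ rewrite ∸-suc (subst (_≤ m) l'≡1+l (toℕ≤m l')) | l'≡1+l = 1+n≈₁n
    close (arcLast l j z 1+l≡1+m) ¬deleted with z ≟ z₀ | j ≟ j₀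
    ... | yes refl | yes refl = ⊥-elim (¬deleted (cong (λ i → mid i j₀) (toℕ-injective (suc-injective (trans 1+l≡1+m (sym 1+i₀≡1+m)))) , refl))
    ... | yes _    | no  _    rewrite suc-injective 1+l≡1+m | n∸n≡0 m = 1+n≈₁n
    ... | no  _    | yes _    rewrite suc-injective 1+l≡1+m | n∸n≡0 m = 1+n≈₁n
    ... | no  _    | no  _    rewrite suc-injective 1+l≡1+m | n∸n≡0 m = n≈₁1+n

    separator : Separator (mid i₀ j₀) (vk z₀)
    separator = record
      { potential = φ ; close = close ; near = vk z₀ ; far = mid fzero j₀
      ; near≡0 = near≡0 ; K<far = K<far }
      where
        near≡0 : φ (vk z₀) ≡ 0
        near≡0 rewrite ≡-≟-identity _≟_ (refl {x = z₀}) = refl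
        K<far : K < φ (mid fzero j₀)
        K<far rewrite ≡-≟-identity _≟_ (refl {x = j₀}) = ≤-refl

  separator : ∀ {u v} → Arc u v → Separator u v
  separator (arc01 x i j i≡0)      = FirstEdge.separator x i j i≡0
  separator (arcPath i i' j i'≡1+i) = PathEdge.separator i i' j i'≡1+i
  separator (arcLast i j z 1+i≡1+m) = LastEdge.separator i j z 1+i≡1+m

  critical : ∀ u v → E u v → DiameterGreaterThan (DeleteEdge E u v) K
  critical u v (inj₁ r) = separator⇒diameter> (separator r)
  critical u v (inj₂ r) = diameter>-⊆ (deleteEdge-comm {E = E}) (separator⇒diameter> (separator r))

lemma3p2 : (k a b c : ℕ) → 2 ≤ k → 1 ≤ a → 1 ≤ b → 1 ≤ c →
    DiameterCritical (Adj k a b c) k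
lemma3p2 (suc (suc m)) (suc a) (suc b) (suc c) (s≤s (s≤s z≤n)) (s≤s z≤n) (s≤s z≤n) (s≤s z≤n) =
  (diameter≤ fzero fzero fzero , vk fzero , v0 fzero , vk-v0-far fzero fzero) , critical
  where open Layered m (suc a) (suc b) (suc c)
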